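{- Let $\mathcal C,\mathcal D$ be stable configuration structures. Then $\mathcal C$ and $\mathcal D$ are hereditary history-preserving (HH) bisimilar if and only if $\mathcal C \equiv_{\mathrm{EIL}} \mathcal D$, i.e. for every closed formula $\phi$ of Event Identifier Logic, $\mathcal C\models\phi$ iff $\mathcal D\models\phi$.
   Context: Configuration structures. A configuration structure over a label alphabet $\mathsf{Act}$ is a pair $\mathcal C=(C,\ell)$ where $C$ is a family of finite sets (configurations) and $\ell:\bigcup_{X\in C}X\to\mathsf{Act}$ is a labelling; $E_{\mathcal C}=\bigcup_{X\in C}X$ is its set of events. It is stable if: $\emptyset\in C$; every nonempty $X\in C$ has some $e\in X$ with $X\setminus\{e\}\in C$; and whenever $X,Y,Z\in C$ with $X\cup Y\subseteq Z$, both $X\cup Y\in C$ and $X\cap Y\in C$. For $X\in C$ define $d\le_X e$ iff for all $Y\in C$ with $Y\subseteq X$, $e\in Y$ implies $d\in Y$; $d<_X e$ iff $d\le_X e$ and $d\ne e$. Write $X\xrightarrow{e}X'$ iff $X,X'\in C$, $X\subseteq X'$ and $X'\setminus X=\{e\}$; $X\xrightarrow{a}X'$ iff $X\xrightarrow{e}X'$ for some $e$ with $\ell(e)=a$. Standing assumption: structures are image finite, i.e. for every configuration $X$ and label $a$ the set $\{X' : X\xrightarrow{a}X'\}$ is finite. For configurations $X$ of $\mathcal C$ and $Y$ of $\mathcal D$, $f:X\cong Y$ means $f$ is a label-preserving bijection $X\to Y$ with $d<_X e\iff f(d)<_Y f(e)$. HH bisimulation. A relation $\mathcal R\subseteq C_{\mathcal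 C}\times C_{\mathcal D}\times\mathcal P(E_{\mathcal C}\times E_{\mathcal D})$ is an HH bisimulation if $\mathcal R(\emptyset,\emptyset,\emptyset)$ and whenever $\mathcal R(X,Y,f)$ and $a\in\mathsf{Act}$: $f:X\cong Y$; if $X\xrightarrow{a}X'$ then there are $Y',f'$ with $Y\xrightarrow{a}Y'$, $\mathcal R(X',Y',f')$ and $f'\restriction X=f$, and symmetrically for moves $Y\xrightarrow{a}Y'$; if $X'\xrightarrow{a}X$ then there are $Y',f'$ with $Y'\xrightarrow{a}Y$, $\mathcal R(X',Y',f')$ and $f\restriction X'=f'$, and symmetrically for $Y'\xrightarrow{a}Y$. $\mathcal C,\mathcal D$ are HH bisimilar if such a relation exists. Event Identifier Logic (EIL). Fix an infinite set of identifiers. Syntax: $\phi::=\mathrm{tt}\mid\neg\phi\mid\phi\wedge\phi'\mid\langle x:a\rangle\phi\mid(x:a)\phi\mid\langle\!\langle x\rangle\!\rangle\phi$ (forward diamond, declaration, reverse diamond). $\langle x:a\rangle$ and $(x:a)$ bind $x$ in $\phi$; $\langle\!\langle x\rangle\!\rangle$ does not bind. Free identifiers: $\mathrm{fi}(\mathrm{tt})=\emptyset$, $\mathrm{fi}(\neg\phi)=\mathrm{fi}(\phi)$, $\mathrm{fi}(\phi_1\wedge\phi_2)=\mathrm{fi}(\phi_1)\cup\mathrm{fi}(\phi_2)$, $\mathrm{fi}(\langle x:a\rangle\phi)=\mathrm{fi}((x:a)\phi)=\mathrm{fi}(\phi)\setminus\{x\}$, $\mathrm{fi}(\langle\!\langle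 x\rangle\!\rangle\phi)=\mathrm{fi}(\phi)\cup\{x\}$; $\phi$ is closed if $\mathrm{fi}(\phi)=\emptyset$. An environment $\rho$ is a partial map from identifiers to events; it is permissible for $\phi$ and $X$ if $\mathrm{fi}(\phi)\subseteq\mathrm{dom}(\rho)$ and $\rho(\mathrm{fi}(\phi))\subseteq X$. $\rho[x\mapsto e]$ is $\rho$ updated at $x$. For $X$ a configuration and $\rho$ permissible for $\phi$ and $X$: $X,\rho\models\mathrm{tt}$ always; $X,\rho\models\neg\phi$ iff not $X,\rho\models\phi$; $X,\rho\models\phi_1\wedge\phi_2$ iff both; $X,\rho\models\langle x:a\rangle\phi$ iff there are $X',e$ with $X\xrightarrow{e}X'$, $\ell(e)=a$ and $X',\rho[x\mapsto e]\models\phi$; $X,\rho\models(x:a)\phi$ iff there is $e\in X$ with $\ell(e)=a$ and $X,\rho[x\mapsto e]\models\phi$; $X,\rho\models\langle\!\langle x\rangle\!\rangle\phi$ iff there are $X',e$ with $X'\xrightarrow{e}X$, $\rho(x)=e$, $\rho$ permissible for $\phi$ and $X'$, and $X',\rho\models\phi$. For closed $\phi$: $\mathcal C\models\phi$ iff $\emptyset,\emptyset\models\phi$ (empty configuration, empty environment). For a set $L$ of formulas, $\mathcal C\equiv_L\mathcal D$ iff for all closed $\phi\in L$, $\mathcal C\models\phi\iff\mathcal D\models\phi$. -}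

module Defs where

open import Level using (0ℓ; Lift)
open import Data.Unit using (⊤)
open import Data.Nat using (ℕ; _≟_)
open import Data.Maybe using (Maybe; just; nothing)
open import Data.Bool using (if_then_else_)
open import Data.List using (List)
open import Data.List.Membership.Propositional using (_∈_)
open import Data.List.Relation.Unary.All using (All)
open import Data.List.Relation.Unary.Any using (Any)
open import Data.Product using (Σ; ∃; ∃-syntax; _×_; _,_)
open import Data.Sum using (_⊎_)
open import Data.Empty using (⊥)
open import Relation.Nullary using (¬_; does)
open import Relation.Binary.PropositionalEquality using (_≡_; _≢_)
open import Function.Bundles using (_⇔_)

-- Sets of events are represented as predicates; set equality is
-- extensional (pointwise logical equivalence).

SubsetOf : Set → Set₁
SubsetOf E = E → Set

module _ {E : Set} where

  ∅ : SubsetOf E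
  ∅ _ = ⊥

  _⊆_ : SubsetOf E → SubsetOf E → Set
  X ⊆ Y = ∀ e → X e → Y e

  _≐_ : SubsetOf E → SubsetOf E → Set
  X ≐ Y = ∀ e → X e ⇔ Y e

  _∪_ : SubsetOf E → SubsetOf E → SubsetOf E
  (X ∪ Y) e = X e ⊎ Y e

  _∩_ : SubsetOf E → SubsetOf E → SubsetOf E
  (X ∩ Y) e = X e × Y e

  _∖｛_｝ : SubsetOf E → E → SubsetOf E
  (X ∖｛ e ｝) d = X d × d ≢ e

  Nonempty : SubsetOf E → Set
  Nonempty X = ∃[ e ] X e

  Finite : SubsetOf E → Set
  Finite X = Σ (List E) λ xs → ∀ e → X e ⇔ (e ∈ xs)

-- Ev is a carrier type of events; the configurations are the finite
-- subsets X of Ev with IsConf X, and the family is closed under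
-- extensional set equality (it is a family of *sets*).

record ConfStr (Act : Set) : Set₁ where
  field
    Ev       : Set
    IsConf   : SubsetOf Ev → Set
    ℓ        : Ev → Act
    conf-fin : ∀ X → IsConf X → Finite X
    conf-ext : ∀ X Y → X ≐ Y → IsConf X → IsConf Y

module _ {Act : Set} (𝒞 : ConfStr Act) where
  open ConfStr 𝒞

  record Stable : Set₁ where
    field
      empty-conf : IsConf ∅
      rooted     : ∀ X → IsConf X → Nonempty X →
                   ∃[ e ] (X e × IsConf (X ∖｛ e ｝))
      closed-∪∩  : ∀ X Y Z → IsConf X → IsConf Y → IsConf Z →
                   (X ∪ Y) ⊆ Z → IsConf (X ∪ Y) × IsConf (X ∩ Y)

  _≤⟨_⟩_ : Ev → SubsetOf Ev → Ev → Set₁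
  d ≤⟨ X ⟩ e = ∀ Y → IsConf Y → Y ⊆ X → Y e → Y d

  _<⟨_⟩_ : Ev → SubsetOf Ev → Ev → Set₁
  d <⟨ X ⟩ e = d ≤⟨ X ⟩ e × d ≢ e

  _—[_]→_ : SubsetOf Ev → Ev → SubsetOf Ev → Set
  X —[ e ]→ X' = IsConf X × IsConf X' × X ⊆ X' ×
                 (∀ d → (X' d × ¬ X d) ⇔ (d ≡ e))

  _—⟨_⟩→_ : SubsetOf Ev → Act → SubsetOf Ev → Set
  X —⟨ a ⟩→ X' = ∃[ e ] (X —[ e ]→ X' × ℓ e ≡ a)

  ImageFinite : Set₁
  ImageFinite = ∀ X a → IsConf X →
    Σ (List (SubsetOf Ev)) λ Xs →
      All (λ X' → X —⟨ a ⟩→ X') Xs ×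
      (∀ X' → X —⟨ a ⟩→ X' → Any (λ X'' → X' ≐ X'') Xs)

module _ {Act : Set} (𝒞 𝒟 : ConfStr Act) where
  private
    module C = ConfStr 𝒞
    module D = ConfStr 𝒟

  EvRel : Set₁
  EvRel = C.Ev → D.Ev → Set

  record Iso (f : EvRel) (X : SubsetOf C.Ev) (Y : SubsetOf D.Ev) : Set₁ where
    field
      f-within    : ∀ d e → f d e → X d × Y e
      f-total     : ∀ d → X d → ∃[ e ] f d e
      f-surj      : ∀ e → Y e → ∃[ d ] f d e
      f-func      : ∀ d e e' → f d e → f d e' → e ≡ e'
      f-inj       : ∀ d d' e → f d e → f d' e → d ≡ d'
      f-label     : ∀ d e → f d e → C.ℓ d ≡ D.ℓ e
      f-order     : ∀ d d' e e' → f d e → f d' e' →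
                    (_<⟨_⟩_ 𝒞 d X d') ⇔ (_<⟨_⟩_ 𝒟 e Y e')

  _↾_≡ʳ_ : EvRel → SubsetOf C.Ev → EvRel → Set
  f' ↾ X ≡ʳ f = ∀ d e → (f' d e × X d) ⇔ f d e

  record IsHH (R : SubsetOf C.Ev → SubsetOf D.Ev → EvRel → Set₁) : Set₁ where
    field
      init   : R ∅ ∅ (λ _ _ → ⊥)
      confs  : ∀ X Y f → R X Y f → C.IsConf X × D.IsConf Y
      iso    : ∀ X Y f → R X Y f → Iso f X Y
      fwd-C  : ∀ X Y f a X' → R X Y f → _—⟨_⟩→_ 𝒞 X a X' →
               ∃[ Y' ] ∃[ f' ] (_—⟨_⟩→_ 𝒟 Y a Y' × R X' Y' f' × f' ↾ X ≡ʳ f)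
      fwd-D  : ∀ X Y f a Y' → R X Y f → _—⟨_⟩→_ 𝒟 Y a Y' →
               ∃[ X' ] ∃[ f' ] (_—⟨_⟩→_ 𝒞 X a X' × R X' Y' f' × f' ↾ X ≡ʳ f)
      bwd-C  : ∀ X Y f a X' → R X Y f → _—⟨_⟩→_ 𝒞 X' a X →
               ∃[ Y' ] ∃[ f' ] (_—⟨_⟩→_ 𝒟 Y' a Y × R X' Y' f' × f ↾ X' ≡ʳ f')
      bwd-D  : ∀ X Y f a Y' → R X Y f → _—⟨_⟩→_ 𝒟 Y' a Y →
               ∃[ X' ] ∃[ f' ] (_—⟨_⟩→_ 𝒞 X' a X × R X' Y' f' × f ↾ X' ≡ʳ f')

  HHBisimilar : Set₂
  HHBisimilar = ∃[ R ] IsHH R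

Ident : Set
Ident = ℕ

data Form (Act : Set) : Set where
  tt     : Form Act
  ¬ᶠ_    : Form Act → Form Act
  _∧ᶠ_   : Form Act → Form Act → Form Act
  ⟨_∶_⟩_ : Ident → Act → Form Act → Form Act   -- forward diamond (binds x)
  [_∶_]_ : Ident → Act → Form Act → Form Act   -- declaration (x : a)φ (binds x)
  ⟪_⟫_   : Ident → Form Act → Form Act         -- reverse diamond (no binding)

FI : {Act : Set} → Form Act → Ident → Set
FI tt x = ⊥
FI (¬ᶠ φ) x = FI φ x
FI (φ ∧ᶠ ψ) x = FI φ x ⊎ FI ψ x
FI (⟨ y ∶ a ⟩ φ) x = FI φ x × x ≢ y
FI ([ y ∶ a ] φ) x = FI φ x × x ≢ y
FI (⟪ y ⟫ φ) x = FI φ x ⊎ x ≡ y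

Closed : {Act : Set} → Form Act → Set
Closed φ = ∀ x → ¬ FI φ x

Env : Set → Set
Env E = Ident → Maybe E

emptyEnv : {E : Set} → Env E
emptyEnv _ = nothing

_[_↦_] : {E : Set} → Env E → Ident → E → Env E
(ρ [ x ↦ e ]) y = if does (y ≟ x) then just e else ρ y

Permissible : {Act E : Set} → Env E → Form Act → SubsetOf E → Set
Permissible ρ φ X = ∀ x → FI φ x → ∃[ e ] (ρ x ≡ just e × X e)

module _ {Act : Set} (𝒞 : ConfStr Act) where
  open ConfStr 𝒞

  -- X, ρ ⊨ φ (only meaningful for ρ permissible for φ and X; the
  -- reverse-diamond clause requires permissibility explicitly, as in
  -- the definition)
  _,_⊨_ : SubsetOf Ev → Env Ev → Form Act → Set₁
  X , ρ ⊨ tt = Lift _ ⊤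
  X , ρ ⊨ (¬ᶠ φ) = ¬ (X , ρ ⊨ φ)
  X , ρ ⊨ (φ ∧ᶠ ψ) = (X , ρ ⊨ φ) × (X , ρ ⊨ ψ)
  X , ρ ⊨ (⟨ x ∶ a ⟩ φ) =
    ∃[ X' ] ∃[ e ] (_—[_]→_ 𝒞 X e X' × ℓ e ≡ a × (X' , ρ [ x ↦ e ] ⊨ φ))
  X , ρ ⊨ ([ x ∶ a ] φ) =
    ∃[ e ] (X e × ℓ e ≡ a × (X , ρ [ x ↦ e ] ⊨ φ))
  X , ρ ⊨ (⟪ x ⟫ φ) =
    ∃[ X' ] ∃[ e ] (_—[_]→_ 𝒞 X' e X × ρ x ≡ just e ×
                    Permissible ρ φ X' × (X' , ρ ⊨ φ))

  _⊨ᶜ_ : Form Act → Set₁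
  _⊨ᶜ_ φ = ∅ , emptyEnv ⊨ φ

EILEquiv : {Act : Set} → ConfStr Act → ConfStr Act → Set₁
EILEquiv {Act} 𝒞 𝒟 = ∀ (φ : Form Act) → Closed φ → (_⊨ᶜ_ 𝒞 φ ⇔ _⊨ᶜ_ 𝒟 φ)

module Submission where

-- Soundness (HH ⇒ EIL, hh⇒eil): an HH bisimulation preserves satisfaction of
-- every formula under environments corresponding along its bijection; this is
-- an induction on formulas, using the converse bisimulation for negation.
--
-- Completeness (EIL ⇒ HH, eil⇒hh): relate (X, Y, f) when f : X ≅ Y and X, Y
-- satisfy the same formulas under all environments corresponding along f.
-- This relation is an HH bisimulation:
--  * backward moves are matched using a reverse diamond ⟪x⟫ on a fresh x;
--  * forward moves by a Hennessy–Milner argument over the finitely many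
--    a-successors of Y, where distinguishing formulas are first renamed to
--    canonical identifiers so that finitely many of them can be conjoined;
--  * order preservation of the extended bijection comes from the "undoing"
--    formulas, which express d ≰_X g in stable structures.

open import Defs
open import Level using (0ℓ; Lift; lift; lower)
open import Function.Bundles using (_⇔_; mk⇔; Equivalence)
import Function.Properties.Equivalence as ⇔
open import Axiom.ExcludedMiddle using (ExcludedMiddle)
open import Data.Unit using () renaming (tt to ⋆)
open import Data.Empty using (⊥; ⊥-elim)
open import Data.Nat using (ℕ; zero; suc; pred; _≤_; _≡ᵇ_; _⊔_)
open import Data.Nat.Properties using (≡ᵇ⇒≡; ≡⇒≡ᵇ; ≤-pred; ≤-trans; ≤-refl; m≤m⊔n; m≤n⊔m; 1+n≰n)
open import Data.Bool using (true; false; T; if_then_else_)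
open import Data.List using (List; []; _∷_; length; filter)
open import Data.List.Properties using (filter-notAll)
open import Data.List.Membership.Propositional using (_∈_)
open import Data.List.Membership.Propositional.Properties using (∈-filter⁺)
import Data.List.Relation.Unary.Any as Any
open import Data.List.Relation.Unary.Any using (Any; here; there)
import Data.List.Relation.Unary.All as All
open import Data.List.Relation.Unary.All using (All; []; _∷_)
open import Data.Maybe using (just; nothing)
import Data.Maybe as Maybe
open import Data.Maybe.Properties using (just-injective)
open import Data.Product using (Σ; ∃-syntax; _×_; _,_; proj₁; proj₂)
open import Data.Sum using (_⊎_; inj₁; inj₂)
open import Relation.Nullary using (¬_; ¬?; Dec; yes; no)
open import Relation.Nullary.Decidable using (map′)
open import Relation.Binary.PropositionalEquality using (_≡_; _≢_; refl; sym; trans; cong; subst)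

open Equivalence using (to; from)

-- Excluded middle at the level of the semantic notions (satisfaction is in Set₁).
EM : Set₃
EM = ExcludedMiddle (Level.suc (Level.suc 0ℓ))

update-cases : ∀ {E : Set} (ρ : Env E) x y e →
  ((ρ [ x ↦ e ]) y ≡ just e × y ≡ x) ⊎ ((ρ [ x ↦ e ]) y ≡ ρ y × y ≢ x)
update-cases ρ x y e with y ≡ᵇ x in q
... | true = inj₁ (refl , ≡ᵇ⇒≡ y x (subst T (sym q) _))
... | false = inj₂ (refl , λ p → subst T q (≡⇒≡ᵇ y x p))

update-here : ∀ {E : Set} (ρ : Env E) x e → (ρ [ x ↦ e ]) x ≡ just e
update-here ρ x e with update-cases ρ x x e
... | inj₁ (p , _) = p
... | inj₂ (_ , x≢x) = ⊥-elim (x≢x refl)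

update-there : ∀ {E : Set} (ρ : Env E) {x y} e → y ≢ x → (ρ [ x ↦ e ]) y ≡ ρ y
update-there ρ {x} {y} e y≢x with update-cases ρ x y e
... | inj₁ (_ , y≡x) = ⊥-elim (y≢x y≡x)
... | inj₂ (p , _) = p

-- Identifier layout used by renaming: bound identifiers are sent to the even
-- numbers ≥ 2 (bound x = 2x+2), free ones to odd "slots" (slot k = 2k+1) or 0.

double : ℕ → ℕ
double zero = zero
double (suc n) = suc (suc (double n))

bound : ℕ → ℕ
bound x = double (suc x)

slot : ℕ → ℕ
slot zero = 1
slot (suc k) = suc (suc (slot k))

pred₂ : ℕ → ℕ
pred₂ (suc (suc k)) = k
pred₂ _ = zero

double-injective : ∀ {m n} → double m ≡ double n → m ≡ n
double-injective {zero} {zero} _ = refl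
double-injective {suc m} {suc n} p = cong suc (double-injective (cong pred₂ p))

slot≢double : ∀ k m → slot k ≢ double m
slot≢double zero zero ()
slot≢double zero (suc m) ()
slot≢double (suc k) zero ()
slot≢double (suc k) (suc m) p = slot≢double k m (cong pred₂ p)

bound-injective : ∀ {x y} → bound x ≡ bound y → x ≡ y
bound-injective p = cong pred (double-injective p)

bindRen : (ℕ → ℕ) → ℕ → ℕ → ℕ
bindRen r x y = if y ≡ᵇ x then bound x else r y

bindRen-cases : ∀ r x y → (bindRen r x y ≡ bound x × y ≡ x) ⊎ (bindRen r x y ≡ r y × y ≢ x)
bindRen-cases r x y with y ≡ᵇ x in q
... | true = inj₁ (refl , ≡ᵇ⇒≡ y x (subst T (sym q) _))
... | false = inj₂ (refl , λ p → subst T q (≡⇒≡ᵇ y x p))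

rename : ∀ {Act : Set} → (ℕ → ℕ) → Form Act → Form Act
rename r tt = tt
rename r (¬ᶠ φ) = ¬ᶠ rename r φ
rename r (φ ∧ᶠ ψ) = rename r φ ∧ᶠ rename r ψ
rename r (⟨ x ∶ a ⟩ φ) = ⟨ bound x ∶ a ⟩ rename (bindRen r x) φ
rename r ([ x ∶ a ] φ) = [ bound x ∶ a ] rename (bindRen r x) φ
rename r (⟪ x ⟫ φ) = ⟪ r x ⟫ rename r φ

-- The renaming r never captures: r y avoids the name reserved for any binder x ≠ y.
Separated : (ℕ → ℕ) → Set
Separated r = ∀ x y → y ≢ x → r y ≢ bound x

separated-bind : ∀ {r} x → Separated r → Separated (bindRen r x)
separated-bind {r} x sep x' y y≢x' with bindRen-cases r x y
... | inj₁ (p , refl) = λ q → y≢x' (bound-injective (trans (sym p) q))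
... | inj₂ (p , _) = λ q → sep x' y y≢x' (trans (sym p) q)

fi-rename⁻ : ∀ {Act : Set} (φ : Form Act) {r y'} → Separated r →
             FI (rename r φ) y' → ∃[ y ] (FI φ y × r y ≡ y')
fi-rename-binder⁻ : ∀ {Act : Set} x (φ : Form Act) {r y'} → Separated r →
                    FI (rename (bindRen r x) φ) y' → y' ≢ bound x →
                    ∃[ y ] ((FI φ y × y ≢ x) × r y ≡ y')

fi-rename⁻ tt sep ()
fi-rename⁻ (¬ᶠ φ) sep fy = fi-rename⁻ φ sep fy
fi-rename⁻ (φ ∧ᶠ ψ) sep (inj₁ fy) = let (y , fy' , ry) = fi-rename⁻ φ sep fy in y , inj₁ fy' , ry
fi-rename⁻ (φ ∧ᶠ ψ) sep (inj₂ fy) = let (y , fy' , ry) = fi-rename⁻ ψ sep fy in y , inj₂ fy' , ry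
fi-rename⁻ (⟨ x ∶ a ⟩ φ) sep (fy , y≢x) = fi-rename-binder⁻ x φ sep fy y≢x
fi-rename⁻ ([ x ∶ a ] φ) sep (fy , y≢x) = fi-rename-binder⁻ x φ sep fy y≢x
fi-rename⁻ (⟪ x ⟫ φ) sep (inj₁ fy) = let (y , fy' , ry) = fi-rename⁻ φ sep fy in y , inj₁ fy' , ry
fi-rename⁻ (⟪ x ⟫ φ) sep (inj₂ refl) = x , inj₂ refl , refl

fi-rename-binder⁻ x φ {r} sep fy y'≢bx with fi-rename⁻ φ (separated-bind x sep) fy
... | y , fy' , q with bindRen-cases r x y
...   | inj₁ (p , _) = ⊥-elim (y'≢bx (trans (sym q) p))
...   | inj₂ (p , y≢x) = y , (fy' , y≢x) , trans (sym p) q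

fi-rename⁺ : ∀ {Act : Set} (φ : Form Act) {r y} → Separated r → FI φ y → FI (rename r φ) (r y)
fi-rename-binder⁺ : ∀ {Act : Set} x (φ : Form Act) {r y} → Separated r →
                    FI φ y → y ≢ x → FI (rename (bindRen r x) φ) (r y) × r y ≢ bound x

fi-rename⁺ tt sep ()
fi-rename⁺ (¬ᶠ φ) sep fy = fi-rename⁺ φ sep fy
fi-rename⁺ (φ ∧ᶠ ψ) sep (inj₁ fy) = inj₁ (fi-rename⁺ φ sep fy)
fi-rename⁺ (φ ∧ᶠ ψ) sep (inj₂ fy) = inj₂ (fi-rename⁺ ψ sep fy)
fi-rename⁺ (⟨ x ∶ a ⟩ φ) sep (fy , y≢x) = fi-rename-binder⁺ x φ sep fy y≢x
fi-rename⁺ ([ x ∶ a ] φ) sep (fy , y≢x) = fi-rename-binder⁺ x φ sep fy y≢x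
fi-rename⁺ (⟪ x ⟫ φ) sep (inj₁ fy) = inj₁ (fi-rename⁺ φ sep fy)
fi-rename⁺ (⟪ x ⟫ φ) sep (inj₂ refl) = inj₂ refl

fi-rename-binder⁺ x φ {r} {y} sep fy y≢x with bindRen-cases r x y
... | inj₁ (_ , y≡x) = ⊥-elim (y≢x y≡x)
... | inj₂ (p , _) = subst (FI (rename (bindRen r x) φ)) p (fi-rename⁺ φ (separated-bind x sep) fy) ,
                     sep x y y≢x

maxIdent : ∀ {Act : Set} → Form Act → ℕ
maxIdent tt = 0
maxIdent (¬ᶠ φ) = maxIdent φ
maxIdent (φ ∧ᶠ ψ) = maxIdent φ ⊔ maxIdent ψ
maxIdent (⟨ x ∶ a ⟩ φ) = maxIdent φ
maxIdent ([ x ∶ a ] φ) = maxIdent φ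
maxIdent (⟪ x ⟫ φ) = x ⊔ maxIdent φ

fi≤maxIdent : ∀ {Act : Set} (φ : Form Act) {y} → FI φ y → y ≤ maxIdent φ
fi≤maxIdent tt ()
fi≤maxIdent (¬ᶠ φ) fy = fi≤maxIdent φ fy
fi≤maxIdent (φ ∧ᶠ ψ) (inj₁ fy) = ≤-trans (fi≤maxIdent φ fy) (m≤m⊔n _ _)
fi≤maxIdent (φ ∧ᶠ ψ) (inj₂ fy) = ≤-trans (fi≤maxIdent ψ fy) (m≤n⊔m _ _)
fi≤maxIdent (⟨ x ∶ a ⟩ φ) (fy , _) = fi≤maxIdent φ fy
fi≤maxIdent ([ x ∶ a ] φ) (fy , _) = fi≤maxIdent φ fy
fi≤maxIdent (⟪ x ⟫ φ) (inj₁ fy) = ≤-trans (fi≤maxIdent φ fy) (m≤n⊔m _ _)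
fi≤maxIdent (⟪ x ⟫ φ) (inj₂ refl) = m≤m⊔n _ _

fresh : ∀ {Act : Set} → Form Act → ℕ
fresh φ = suc (maxIdent φ)

fresh-not-free : ∀ {Act : Set} (φ : Form Act) y → FI φ y → y ≢ fresh φ
fresh-not-free φ y fy refl = 1+n≰n (fi≤maxIdent φ fy)

-- The undoing formulas.  keeps₁ is equivalent to tt but has identifier 1
-- free, so a reverse step to a state satisfying it must keep the event ρ(1).
-- undoing bs undoes events labelled bs, then undoes ρ(0) while keeping ρ(1);
-- in a stable structure it is satisfiable at W exactly when ρ(0) ≰_W ρ(1).
keeps₁ : ∀ {Act : Set} → Form Act
keeps₁ = ¬ᶠ ((⟪ 1 ⟫ tt) ∧ᶠ (¬ᶠ tt))

undoing : ∀ {Act : Set} → List Act → Form Act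
undoing [] = ⟪ 0 ⟫ keeps₁
undoing (b ∷ bs) = [ 2 ∶ b ] (⟪ 2 ⟫ undoing bs)

fi-undoing : ∀ {Act : Set} (bs : List Act) y → FI (undoing bs) y → (y ≡ 0) ⊎ (y ≡ 1)
fi-undoing [] y (inj₁ (inj₁ (inj₁ ())))
fi-undoing [] y (inj₁ (inj₁ (inj₂ y≡1))) = inj₂ y≡1
fi-undoing [] y (inj₁ (inj₂ ()))
fi-undoing [] y (inj₂ y≡0) = inj₁ y≡0
fi-undoing (b ∷ bs) y (inj₁ fy , _) = fi-undoing bs y fy
fi-undoing (b ∷ bs) y (inj₂ y≡2 , y≢2) = ⊥-elim (y≢2 y≡2)

pairEnv : ∀ {E : Set} → E → E → Env E
pairEnv a b zero = just a
pairEnv a b (suc zero) = just b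
pairEnv a b (suc (suc _)) = nothing

module Structure {Act : Set} (em : EM) (𝒞 : ConfStr Act) where
  open ConfStr 𝒞

  Sat : SubsetOf Ev → Env Ev → Form Act → Set₁
  Sat = _,_⊨_ 𝒞

  Step : SubsetOf Ev → Ev → SubsetOf Ev → Set
  Step = _—[_]→_ 𝒞

  decide : (P : Set) → Dec P
  decide P = map′ lower lift (em {Lift _ P})

  decide₁ : (P : Set₁) → Dec P
  decide₁ P = map′ lower lift (em {Lift _ P})

  ≐-refl : {X : SubsetOf Ev} → X ≐ X
  ≐-refl e = ⇔.refl

  ≐-sym : {X Y : SubsetOf Ev} → X ≐ Y → Y ≐ X
  ≐-sym X≐Y e = ⇔.sym (X≐Y e)

  step-source-≐ : ∀ {X X' W e} → X ≐ X' → Step X e W → Step X' e W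
  step-source-≐ {X} {X'} {W} {e} eq (cX , cW , X⊆W , new) =
    conf-ext X X' eq cX , cW , (λ d x → X⊆W d (from (eq d) x)) ,
    λ d → mk⇔ (λ (Wd , ¬X'd) → to (new d) (Wd , λ Xd → ¬X'd (to (eq d) Xd)))
              (λ d≡e → let (Wd , ¬Xd) = from (new d) d≡e in Wd , λ X'd → ¬Xd (from (eq d) X'd))

  step-target-≐ : ∀ {X W W' e} → W ≐ W' → Step X e W → Step X e W'
  step-target-≐ {X} {W} {W'} {e} eq (cX , cW , X⊆W , new) =
    cX , conf-ext W W' eq cW , (λ d x → to (eq d) (X⊆W d x)) ,
    λ d → mk⇔ (λ (W'd , ¬Xd) → to (new d) (from (eq d) W'd , ¬Xd))
              (λ d≡e → let (Wd , ¬Xd) = from (new d) d≡e in to (eq d) Wd , ¬Xd)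

  step-new : ∀ {X X' e} → Step X e X' → X' e × ¬ X e
  step-new (_ , _ , _ , new) = from (new _) refl

  step-old : ∀ {X X' e d} → Step X e X' → X' d → d ≢ e → X d
  step-old {X} {d = d} (_ , _ , _ , new) X'd d≢e with decide (X d)
  ... | yes Xd = Xd
  ... | no ¬Xd = ⊥-elim (d≢e (to (new d) (X'd , ¬Xd)))

  step-source-unique : ∀ {W W' X e} → Step W e X → Step W' e X → W ≐ W'
  step-source-unique {W} {W'} {X} {e} (_ , _ , W⊆X , new) (_ , _ , W'⊆X , new') x =
    mk⇔ (inside new new' W⊆X) (inside new' new W'⊆X)
    where
      inside : ∀ {A B : SubsetOf Ev} → (∀ d → (X d × ¬ A d) ⇔ (d ≡ e)) →
               (∀ d → (X d × ¬ B d) ⇔ (d ≡ e)) → A ⊆ X → A x → B x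
      inside {A} {B} newA newB A⊆X Ax with decide (B x)
      ... | yes Bx = Bx
      ... | no ¬Bx with to (newB x) (A⊆X x Ax , ¬Bx)
      ...   | refl = ⊥-elim (proj₂ (from (newA x) refl) Ax)

  step-event-unique : ∀ {Y Y' Y'' e e'} → Step Y e Y' → Step Y e' Y'' → Y' ≐ Y'' → e ≡ e'
  step-event-unique (_ , _ , _ , new) (_ , _ , _ , new') eq =
    let (Y'e , ¬Ye) = from (new _) refl in to (new' _) (to (eq _) Y'e , ¬Ye)

  Agree : Form Act → Env Ev → Env Ev → Set
  Agree φ ρ σ = ∀ y → FI φ y → ρ y ≡ σ y

  agree-bind : ∀ (φ : Form Act) x (ρ σ : Env Ev) e →
               (∀ y → FI φ y → y ≢ x → ρ y ≡ σ y) → Agree φ (ρ [ x ↦ e ]) (σ [ x ↦ e ])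
  agree-bind φ x ρ σ e agree y fy with update-cases ρ x y e | update-cases σ x y e
  ... | inj₁ (p , _) | inj₁ (q , _) = trans p (sym q)
  ... | inj₁ (_ , y≡x) | inj₂ (_ , y≢x) = ⊥-elim (y≢x y≡x)
  ... | inj₂ (_ , y≢x) | inj₁ (_ , y≡x) = ⊥-elim (y≢x y≡x)
  ... | inj₂ (p , y≢x) | inj₂ (q , _) = trans p (trans (agree y fy y≢x) (sym q))

  sat-transport : ∀ φ {X X' ρ σ} → X ≐ X' → Agree φ ρ σ → Sat X ρ φ → Sat X' σ φ
  sat-transport tt _ _ s = s
  sat-transport (¬ᶠ φ) eq agree ¬s s' =
    ¬s (sat-transport φ (≐-sym eq) (λ y fy → sym (agree y fy)) s')
  sat-transport (φ ∧ᶠ ψ) eq agree (s , t) =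
    sat-transport φ eq (λ y fy → agree y (inj₁ fy)) s , sat-transport ψ eq (λ y fy → agree y (inj₂ fy)) t
  sat-transport (⟨ x ∶ a ⟩ φ) {ρ = ρ} {σ} eq agree (X'' , e , step , lab , s) =
    X'' , e , step-source-≐ eq step , lab ,
    sat-transport φ ≐-refl (agree-bind φ x ρ σ e (λ y fy y≢x → agree y (fy , y≢x))) s
  sat-transport ([ x ∶ a ] φ) {ρ = ρ} {σ} eq agree (e , Xe , lab , s) =
    e , to (eq e) Xe , lab ,
    sat-transport φ eq (agree-bind φ x ρ σ e (λ y fy y≢x → agree y (fy , y≢x))) s
  sat-transport (⟪ x ⟫ φ) eq agree (W , e , step , ρx , perm , s) =
    W , e , step-target-≐ eq step , trans (sym (agree x (inj₂ refl))) ρx ,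
    (λ y fy → let (d , ρy , Wd) = perm y fy in d , trans (sym (agree y (inj₁ fy))) ρy , Wd) ,
    sat-transport φ ≐-refl (λ y fy → agree y (inj₁ fy)) s

  RenamingFits : (ℕ → ℕ) → Form Act → Env Ev → Env Ev → Set
  RenamingFits r φ σ ρ = ∀ y → FI φ y → σ (r y) ≡ ρ y

  fits-bind : ∀ {r} x (φ : Form Act) {σ ρ} e → Separated r →
              (∀ y → FI φ y → y ≢ x → σ (r y) ≡ ρ y) →
              RenamingFits (bindRen r x) φ (σ [ bound x ↦ e ]) (ρ [ x ↦ e ])
  fits-bind {r} x φ {σ} {ρ} e sep fits y fy with bindRen-cases r x y
  ... | inj₁ (p , refl) =
    trans (cong (σ [ bound x ↦ e ]) p) (trans (update-here σ (bound x) e) (sym (update-here ρ x e)))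
  ... | inj₂ (p , y≢x) =
    trans (cong (σ [ bound x ↦ e ]) p)
      (trans (update-there σ e (sep x y y≢x)) (trans (fits y fy y≢x) (sym (update-there ρ e y≢x))))

  sat-rename : ∀ φ {r X σ ρ} → Separated r → RenamingFits r φ σ ρ → Sat X σ (rename r φ) ⇔ Sat X ρ φ
  sat-rename-bind : ∀ x φ {r X σ ρ} e → Separated r → (∀ y → FI φ y → y ≢ x → σ (r y) ≡ ρ y) →
                    Sat X (σ [ bound x ↦ e ]) (rename (bindRen r x) φ) ⇔ Sat X (ρ [ x ↦ e ]) φ

  sat-rename tt sep fits = ⇔.refl
  sat-rename (¬ᶠ φ) sep fits =
    mk⇔ (λ ¬s s → ¬s (from (sat-rename φ sep fits) s)) (λ ¬s s → ¬s (to (sat-rename φ sep fits) s))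
  sat-rename (φ ∧ᶠ ψ) sep fits =
    let l = sat-rename φ sep (λ y fy → fits y (inj₁ fy))
        r = sat-rename ψ sep (λ y fy → fits y (inj₂ fy)) in
    mk⇔ (λ (s , t) → to l s , to r t) (λ (s , t) → from l s , from r t)
  sat-rename (⟨ x ∶ a ⟩ φ) sep fits = mk⇔
    (λ (X' , e , step , lab , s) → X' , e , step , lab , to (sat-rename-bind x φ e sep fits') s)
    (λ (X' , e , step , lab , s) → X' , e , step , lab , from (sat-rename-bind x φ e sep fits') s)
    where fits' = λ y fy y≢x → fits y (fy , y≢x)
  sat-rename ([ x ∶ a ] φ) sep fits = mk⇔
    (λ (e , Xe , lab , s) → e , Xe , lab , to (sat-rename-bind x φ e sep fits') s)
    (λ (e , Xe , lab , s) → e , Xe , lab , from (sat-rename-bind x φ e sep fits') s)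
    where fits' = λ y fy y≢x → fits y (fy , y≢x)
  sat-rename (⟪ x ⟫ φ) {r} {σ = σ} sep fits = mk⇔
    (λ (W , e , step , σrx , perm , s) → W , e , step , trans (sym (fits x (inj₂ refl))) σrx ,
        (λ y fy → let (d , σry , Wd) = perm (r y) (fi-rename⁺ φ sep fy) in
                  d , trans (sym (fits y (inj₁ fy))) σry , Wd) ,
        to (sat-rename φ sep fits') s)
    (λ (W , e , step , ρx , perm , s) → W , e , step , trans (fits x (inj₂ refl)) ρx ,
        (λ y' fy' → let (y , fy , ry≡y') = fi-rename⁻ φ sep fy' ; (d , ρy , Wd) = perm y fy in
                    d , trans (cong σ (sym ry≡y')) (trans (fits y (inj₁ fy)) ρy) , Wd) ,
        from (sat-rename φ sep fits') s)
    where
      fits' : RenamingFits r φ σ _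
      fits' y fy = fits y (inj₁ fy)

  sat-rename-bind x φ {σ = σ} {ρ} e sep fits =
    sat-rename φ (separated-bind x sep) (fits-bind x φ {σ} {ρ} e sep fits)

  undo-fresh⁺ : ∀ φ {X X' e ρ} → Step X' e X → Permissible ρ φ X' → Sat X' ρ φ →
                Sat X (ρ [ fresh φ ↦ e ]) (⟪ fresh φ ⟫ φ)
  undo-fresh⁺ φ {e = e} {ρ} step perm s =
    _ , e , step , update-here ρ (fresh φ) e ,
    (λ y fy → let (d , ρy , X'd) = perm y fy in d , trans (update-there ρ e (fresh-not-free φ y fy)) ρy , X'd) ,
    sat-transport φ ≐-refl (λ y fy → sym (update-there ρ e (fresh-not-free φ y fy))) s

  undo-fresh⁻ : ∀ φ {X X' e ρ} → Step X' e X → Sat X (ρ [ fresh φ ↦ e ]) (⟪ fresh φ ⟫ φ) → Sat X' ρ φ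
  undo-fresh⁻ φ {e = e} {ρ} step (W , e' , stepW , ρx≡e' , _ , s)
    with just-injective (trans (sym (update-here ρ (fresh φ) e)) ρx≡e')
  ... | refl = sat-transport φ (step-source-unique stepW step) (λ y fy → update-there ρ e (fresh-not-free φ y fy)) s

  SizeAtMost : ℕ → SubsetOf Ev → Set
  SizeAtMost n W = Σ (List Ev) λ xs → length xs ≤ n × (∀ x → W x → x ∈ xs)

  conf-size : ∀ {W} → IsConf W → ∃[ n ] SizeAtMost n W
  conf-size {W} cW = let (xs , W≐xs) = conf-fin W cW in length xs , xs , ≤-refl , λ x Wx → to (W≐xs x) Wx

  size-remove : ∀ {n W h} → SizeAtMost (suc n) W → W h → SizeAtMost n (W ∖｛ h ｝)
  size-remove {n} {W} {h} (xs , len , mem) Wh =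
    filter ≢h? xs ,
    ≤-pred (≤-trans (filter-notAll ≢h? xs (Any.map (λ h≡x x≢h → x≢h (sym h≡x)) (mem h Wh))) len) ,
    λ x (Wx , x≢h) → ∈-filter⁺ ≢h? (mem x Wx) x≢h
    where
      ≢h? : ∀ x → Dec (x ≢ h)
      ≢h? x = ¬? (decide (x ≡ h))

  size-zero-empty : ∀ {W x} → SizeAtMost 0 W → ¬ W x
  size-zero-empty ([] , _ , mem) Wx with mem _ Wx
  ... | ()

  step-remove : ∀ {W h} → IsConf W → IsConf (W ∖｛ h ｝) → W h → Step (W ∖｛ h ｝) h W
  step-remove {W} {h} cW cW∖h Wh = cW∖h , cW , (λ d (Wd , _) → Wd) ,
    λ d → mk⇔ (λ (Wd , ¬W∖hd) → removed d Wd ¬W∖hd) (λ { refl → Wh , λ (_ , h≢h) → h≢h refl })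
    where
      removed : ∀ d → W d → ¬ (W ∖｛ h ｝) d → d ≡ h
      removed d Wd ¬W∖hd with decide (d ≡ h)
      ... | yes d≡h = d≡h
      ... | no d≢h = ⊥-elim (¬W∖hd (Wd , d≢h))

  separating-conf : ∀ {W d g} → ¬ (_≤⟨_⟩_ 𝒞 d W g) →
                    Σ (SubsetOf Ev) λ Z → IsConf Z × Z ⊆ W × Z g × ¬ Z d
  separating-conf {W} {d} {g} d≰g with decide₁ (Σ (SubsetOf Ev) λ Z → IsConf Z × Z ⊆ W × Z g × ¬ Z d)
  ... | yes Z = Z
  ... | no ¬Z = ⊥-elim (d≰g λ Z cZ Z⊆W Zg → contains-d Z cZ Z⊆W Zg)
    where
      contains-d : ∀ Z → IsConf Z → Z ⊆ W → Z g → Z d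
      contains-d Z cZ Z⊆W Zg with decide (Z d)
      ... | yes Zd = Zd
      ... | no ¬Zd = ⊥-elim (¬Z (Z , cZ , Z⊆W , Zg , ¬Zd))

  module Stability (st : Stable 𝒞) where
    open Stable st

    conf-∪ : ∀ {A B C} → IsConf A → IsConf B → IsConf C → A ⊆ C → B ⊆ C → IsConf (A ∪ B)
    conf-∪ {A} {B} {C} cA cB cC A⊆C B⊆C =
      proj₁ (closed-∪∩ A B C cA cB cC λ { x (inj₁ a) → A⊆C x a ; x (inj₂ b) → B⊆C x b })

    conf-∩ : ∀ {A B C} → IsConf A → IsConf B → IsConf C → A ⊆ C → B ⊆ C → IsConf (A ∩ B)
    conf-∩ {A} {B} {C} cA cB cC A⊆C B⊆C =
      proj₂ (closed-∪∩ A B C cA cB cC λ { x (inj₁ a) → A⊆C x a ; x (inj₂ b) → B⊆C x b })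

    -- If W ∖ {g, h} is a configuration and g ∈ Z, h ∉ Z for a configuration
    -- Z ⊆ W, then W ∖ {h} = (W ∖ {g, h}) ∪ Z is a configuration.
    reinsert : ∀ {W Z g h} → IsConf W → IsConf Z → Z ⊆ W → Z g → ¬ Z h →
               IsConf ((W ∖｛ g ｝) ∖｛ h ｝) → IsConf (W ∖｛ h ｝)
    reinsert {W} {Z} {g} {h} cW cZ Z⊆W Zg ¬Zh cW∖gh =
      conf-ext _ _ union≐ (conf-∪ cW∖gh cZ cW (λ d ((Wd , _) , _) → Wd) Z⊆W)
      where
        union≐ : (((W ∖｛ g ｝) ∖｛ h ｝) ∪ Z) ≐ (W ∖｛ h ｝)
        union≐ d = mk⇔ (λ { (inj₁ ((Wd , _) , d≢h)) → Wd , d≢h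
                          ; (inj₂ Zd) → Z⊆W d Zd , λ { refl → ¬Zh Zd } })
                       (λ (Wd , d≢h) → split Wd d≢h)
          where
            split : W d → d ≢ h → (((W ∖｛ g ｝) ∖｛ h ｝) ∪ Z) d
            split Wd d≢h with decide (d ≡ g)
            ... | yes refl = inj₂ Zg
            ... | no d≢g = inj₁ ((Wd , d≢g) , d≢h)

    removable-outside : ∀ n {W Z w} → SizeAtMost n W → IsConf Z → IsConf W → Z ⊆ W → W w → ¬ Z w →
                        ∃[ h ] (W h × ¬ Z h × IsConf (W ∖｛ h ｝))
    removable-outside zero sz cZ cW Z⊆W Ww ¬Zw = ⊥-elim (size-zero-empty sz Ww)
    removable-outside (suc n) {W} {Z} {w} sz cZ cW Z⊆W Ww ¬Zw with rooted W cW (w , Ww)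
    ... | g , Wg , cW∖g with decide (Z g)
    ...   | no ¬Zg = g , Wg , ¬Zg , cW∖g
    ...   | yes Zg with removable-outside n {W ∖｛ g ｝} {Z ∩ (W ∖｛ g ｝)} {w} (size-remove sz Wg)
                          (conf-∩ cZ cW∖g cW Z⊆W (λ d (Wd , _) → Wd)) cW∖g (λ d (_ , W∖gd) → W∖gd)
                          (Ww , λ { refl → ¬Zw Zg }) (λ (Zw , _) → ¬Zw Zw)
    ...     | h , (Wh , h≢g) , ¬Z∩h , cW∖gh = h , Wh , ¬Zh , reinsert cW cZ Z⊆W Zg ¬Zh cW∖gh
      where
        ¬Zh : ¬ Z h
        ¬Zh Zh = ¬Z∩h (Zh , Wh , h≢g)

    undoing-sound : ∀ bs {W ρ d g} → Sat W ρ (undoing bs) → ρ 0 ≡ just d → ρ 1 ≡ just g →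
                    ¬ (_≤⟨_⟩_ 𝒞 d W g)
    undoing-sound [] {W} {ρ} {d} {g} (W' , e , (cW' , _ , W'⊆W , new) , ρ0 , perm , _) ρ0≡d ρ1≡g d≤g
      with perm 1 (inj₁ (inj₂ refl))
    ... | g' , ρ1≡g' , W'g' with just-injective (trans (sym ρ0≡d) ρ0) | just-injective (trans (sym ρ1≡g') ρ1≡g)
    ...   | refl | refl = proj₂ (from (new d) refl) (d≤g W' cW' W'⊆W W'g')
    undoing-sound (b ∷ bs) (_ , _ , _ , (W' , _ , (_ , _ , W'⊆W , _) , _ , _ , s)) ρ0≡d ρ1≡g d≤g =
      undoing-sound bs s ρ0≡d ρ1≡g (λ Z cZ Z⊆W' Zg → d≤g Z cZ (λ x z → W'⊆W x (Z⊆W' x z)) Zg)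

    -- Completeness, by induction on the size of W: peel off events outside
    -- the separating configuration Z until d itself can be undone.
    undoing-complete : ∀ n {W Z d g} → SizeAtMost n W → IsConf W → IsConf Z → Z ⊆ W → Z g → ¬ Z d →
                       W d → ∀ (ρ : Env Ev) → ρ 0 ≡ just d → ρ 1 ≡ just g → ∃[ bs ] Sat W ρ (undoing bs)
    undoing-complete zero sz cW cZ Z⊆W Zg ¬Zd Wd ρ ρ0 ρ1 = ⊥-elim (size-zero-empty sz Wd)
    undoing-complete (suc n) {W} {Z} {d} {g} sz cW cZ Z⊆W Zg ¬Zd Wd ρ ρ0 ρ1
      with removable-outside (suc n) sz cZ cW Z⊆W Wd ¬Zd
    ... | h , Wh , ¬Zh , cW∖h with decide (h ≡ d)
    ...   | yes refl = [] , (W ∖｛ h ｝) , h , step-remove cW cW∖h Wh , ρ0 , perm , λ (_ , ¬⊤) → ¬⊤ (lift ⋆)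
      where
        perm : Permissible ρ (keeps₁ {Act}) (W ∖｛ h ｝)
        perm y (inj₁ (inj₁ ()))
        perm y (inj₁ (inj₂ refl)) = g , ρ1 , Z⊆W g Zg , λ { refl → ¬Zh Zg }
        perm y (inj₂ ())
    ...   | no h≢d with undoing-complete n {W ∖｛ h ｝} {Z} {d} {g} (size-remove sz Wh) cW∖h cZ
                          (λ x Zx → Z⊆W x Zx , λ { refl → ¬Zh Zx }) Zg ¬Zd (Wd , λ { refl → h≢d refl })
                          (ρ [ 2 ↦ h ]) ρ0 ρ1
    ...     | bs , s = ℓ h ∷ bs , h , Wh , refl , (W ∖｛ h ｝) , h , step-remove cW cW∖h Wh , refl , perm , s
      where
        perm : Permissible (ρ [ 2 ↦ h ]) (undoing bs) (W ∖｛ h ｝)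
        perm y fy with fi-undoing bs y fy
        ... | inj₁ refl = d , ρ0 , Wd , λ { refl → h≢d refl }
        ... | inj₂ refl = g , ρ1 , Z⊆W g Zg , λ { refl → ¬Zh Zg }

    not-below⇒undoing : ∀ {W d g} → IsConf W → W d → ¬ (_≤⟨_⟩_ 𝒞 d W g) →
                        ∃[ bs ] Sat W (pairEnv d g) (undoing bs)
    not-below⇒undoing cW Wd d≰g =
      let (Z , cZ , Z⊆W , Zg , ¬Zd) = separating-conf d≰g
          (n , sz) = conf-size cW in
      undoing-complete n sz cW cZ Z⊆W Zg ¬Zd Wd (pairEnv _ _) refl refl

    ≤-restrict : ∀ {A B d d'} → IsConf A → IsConf B → A ⊆ B → A d' →
                 (_≤⟨_⟩_ 𝒞 d A d') ⇔ (_≤⟨_⟩_ 𝒞 d B d')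
    ≤-restrict {A} {B} cA cB A⊆B Ad' = mk⇔
      (λ d≤A Z cZ Z⊆B Zd' → proj₁ (d≤A (Z ∩ A) (conf-∩ cZ cA cB Z⊆B A⊆B) (λ x (_ , Ax) → Ax) (Zd' , Ad')))
      (λ d≤B Z cZ Z⊆A Zd' → d≤B Z cZ (λ x z → A⊆B x (Z⊆A x z)) Zd')

    <-restrict : ∀ {A B d d'} → IsConf A → IsConf B → A ⊆ B → A d' →
                 (_<⟨_⟩_ 𝒞 d A d') ⇔ (_<⟨_⟩_ 𝒞 d B d')
    <-restrict cA cB A⊆B Ad' = let eq = ≤-restrict cA cB A⊆B Ad' in
      mk⇔ (λ (le , ne) → to eq le , ne) (λ (le , ne) → from eq le , ne)

converse : ∀ {A B : Set} → (A → B → Set) → (B → A → Set)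
converse f e d = f d e

module Pair {Act : Set} (𝒞 𝒟 : ConfStr Act) where
  private
    module C = ConfStr 𝒞
    module D = ConfStr 𝒟

  iso-converse : ∀ {f X Y} → Iso 𝒞 𝒟 f X Y → Iso 𝒟 𝒞 (converse f) Y X
  iso-converse i = record
    { f-within = λ e d p → let (Xd , Ye) = f-within d e p in Ye , Xd
    ; f-total = f-surj
    ; f-surj = f-total
    ; f-func = λ e d d' p q → f-inj d d' e p q
    ; f-inj = λ e e' d p q → f-func d e e' p q
    ; f-label = λ e d p → sym (f-label d e p)
    ; f-order = λ e e' d d' p q → ⇔.sym (f-order d d' e e' p q) }
    where open Iso i

  Corresponds : EvRel 𝒞 𝒟 → Form Act → Env C.Ev → Env D.Ev → Set
  Corresponds f φ ρ ρ' = ∀ x → FI φ x → ∃[ d ] ∃[ e ] (ρ x ≡ just d × ρ' x ≡ just e × f d e)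

  corresponds-converse : ∀ {f φ ρ ρ'} → Corresponds f φ ρ ρ' →
                         ∀ x → FI φ x → ∃[ e ] ∃[ d ] (ρ' x ≡ just e × ρ x ≡ just d × converse f e d)
  corresponds-converse c x fx = let (d , e , ρx , ρ'x , fde) = c x fx in e , d , ρ'x , ρx , fde

  -- When h : X' ≅ Y' is the restriction of g : X ≅ Y to X', it is also its
  -- restriction to Y' (used to transfer restriction conditions to the converse).
  restriction-swap : ∀ {g h X Y X' Y'} → Iso 𝒞 𝒟 g X Y → Iso 𝒞 𝒟 h X' Y' →
                     (∀ d e → (g d e × X' d) ⇔ h d e) → (∀ d e → (g d e × Y' e) ⇔ h d e)
  restriction-swap {g} {h} ig ih restr d e = mk⇔
    (λ (gde , Y'e) → let (d' , hd'e) = Iso.f-surj ih e Y'e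
                         (gd'e , _) = from (restr d' e) hd'e in
                     subst (λ z → h z e) (Iso.f-inj ig d' d e gd'e gde) hd'e)
    (λ hde → proj₁ (from (restr d e) hde) , proj₂ (Iso.f-within ih d e hde))

  hh-converse : ∀ {R} → IsHH 𝒞 𝒟 R → IsHH 𝒟 𝒞 (λ Y X g → R X Y (converse g))
  hh-converse {R} H = record
    { init = init
    ; confs = λ Y X g r → let (cX , cY) = confs X Y (converse g) r in cY , cX
    ; iso = λ Y X g r → iso-converse (iso X Y (converse g) r)
    ; fwd-C = λ Y X g a Y' r mv → let (X' , f' , mv' , r' , restr) = fwd-D X Y (converse g) a Y' r mv in
         X' , converse f' , mv' , r' ,
         λ e d → restriction-swap (iso X' Y' f' r') (iso X Y (converse g) r) restr d e
    ; fwd-D = λ Y X g a X' r mv → let (Y' , f' , mv' , r' , restr) = fwd-C X Y (converse g) a X' r mv in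
         Y' , converse f' , mv' , r' ,
         λ e d → restriction-swap (iso X' Y' f' r') (iso X Y (converse g) r) restr d e
    ; bwd-C = λ Y X g a Y' r mv → let (X' , f' , mv' , r' , restr) = bwd-D X Y (converse g) a Y' r mv in
         X' , converse f' , mv' , r' ,
         λ e d → restriction-swap (iso X Y (converse g) r) (iso X' Y' f' r') restr d e
    ; bwd-D = λ Y X g a X' r mv → let (Y' , f' , mv' , r' , restr) = bwd-C X Y (converse g) a X' r mv in
         Y' , converse f' , mv' , r' ,
         λ e d → restriction-swap (iso X Y (converse g) r) (iso X' Y' f' r') restr d e
    }
    where open IsHH H

  corresponds-bind : ∀ {f g : EvRel 𝒞 𝒟} φ x {ρ ρ' d e} →
                     (∀ y → FI φ y → y ≢ x → ∃[ d ] ∃[ e ] (ρ y ≡ just d × ρ' y ≡ just e × f d e)) →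
                     (∀ d e → f d e → g d e) → g d e →
                     Corresponds g φ (ρ [ x ↦ d ]) (ρ' [ x ↦ e ])
  corresponds-bind φ x {ρ} {ρ'} {d} {e} c f⊆g gde y fy with update-cases ρ x y d | update-cases ρ' x y e
  ... | inj₁ (ρy , _) | inj₁ (ρ'y , _) = d , e , ρy , ρ'y , gde
  ... | inj₁ (_ , y≡x) | inj₂ (_ , y≢x) = ⊥-elim (y≢x y≡x)
  ... | inj₂ (_ , y≢x) | inj₁ (_ , y≡x) = ⊥-elim (y≢x y≡x)
  ... | inj₂ (ρy , y≢x) | inj₂ (ρ'y , _) =
    let (d' , e' , ρy≡ , ρ'y≡ , fd'e') = c y fy y≢x in d' , e' , trans ρy ρy≡ , trans ρ'y ρ'y≡ , f⊆g d' e' fd'e'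

  corresponds-restrict : ∀ {f f' φ ρ ρ' X'} → Corresponds f φ ρ ρ' → Permissible ρ φ X' →
                         _↾_≡ʳ_ 𝒞 𝒟 f X' f' → Corresponds f' φ ρ ρ'
  corresponds-restrict c perm restr y fy with c y fy | perm y fy
  ... | d , e , ρy , ρ'y , fde | d' , ρy' , X'd' with just-injective (trans (sym ρy) ρy')
  ...   | refl = d , e , ρy , ρ'y , to (restr d e) (fde , X'd')

  corresponds-permissible : ∀ {f φ ρ ρ' X Y} → Iso 𝒞 𝒟 f X Y → Corresponds f φ ρ ρ' → Permissible ρ' φ Y
  corresponds-permissible i c y fy = let (d , e , _ , ρ'y , fde) = c y fy in e , ρ'y , proj₂ (Iso.f-within i d e fde)

  step-matched : ∀ {f f' X Y X' Y' e e'} → Iso 𝒞 𝒟 f X Y → Iso 𝒞 𝒟 f' X' Y' → _↾_≡ʳ_ 𝒞 𝒟 f' X f →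
                 _—[_]→_ 𝒞 X e X' → _—[_]→_ 𝒟 Y e' Y' → f' e e'
  step-matched {f} {f'} {X} {Y} {X'} {Y'} {e} {e'} i i' restr (_ , _ , _ , newX) (_ , _ , _ , newY)
    with Iso.f-total i' e (proj₁ (from (newX e) refl))
  ... | e'' , f'ee'' = subst (f' e) (to (newY e'') (proj₂ (Iso.f-within i' e e'' f'ee'') , ¬Ye'')) f'ee''
    where
      ¬Ye'' : ¬ Y e''
      ¬Ye'' Ye'' = let (d , fde'') = Iso.f-surj i e'' Ye''
                       (f'de'' , Xd) = from (restr d e'') fde'' in
                   proj₂ (from (newX e) refl) (subst X (Iso.f-inj i' d e e'' f'de'' f'ee'') Xd)

hh-preserves-sat : ∀ {Act : Set} (𝒞 𝒟 : ConfStr Act) R → IsHH 𝒞 𝒟 R →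
                   ∀ φ {X Y f ρ ρ'} → R X Y f → Pair.Corresponds 𝒞 𝒟 f φ ρ ρ' →
                   _,_⊨_ 𝒞 X ρ φ → _,_⊨_ 𝒟 Y ρ' φ
hh-preserves-sat 𝒞 𝒟 R H tt r c s = s
hh-preserves-sat 𝒞 𝒟 R H (¬ᶠ φ) r c ¬s s' =
  ¬s (hh-preserves-sat 𝒟 𝒞 _ (Pair.hh-converse 𝒞 𝒟 H) φ r (Pair.corresponds-converse 𝒞 𝒟 {φ = φ} c) s')
hh-preserves-sat 𝒞 𝒟 R H (φ ∧ᶠ ψ) r c (s , t) =
  hh-preserves-sat 𝒞 𝒟 R H φ r (λ x fx → c x (inj₁ fx)) s ,
  hh-preserves-sat 𝒞 𝒟 R H ψ r (λ x fx → c x (inj₂ fx)) t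
hh-preserves-sat 𝒞 𝒟 R H (⟨ x ∶ a ⟩ φ) {X} {Y} {f} r c (X' , e , stepX , lab , s)
  with IsHH.fwd-C H X Y f a X' r (e , stepX , lab)
... | Y' , f' , (e' , stepY , lab') , r' , restr =
  Y' , e' , stepY , lab' ,
  hh-preserves-sat 𝒞 𝒟 R H φ r'
    (Pair.corresponds-bind 𝒞 𝒟 φ x (λ y fy y≢x → c y (fy , y≢x)) (λ d e fde → proj₁ (from (restr d e) fde))
       (Pair.step-matched 𝒞 𝒟 (IsHH.iso H X Y f r) (IsHH.iso H X' Y' f' r') restr stepX stepY))
    s
hh-preserves-sat 𝒞 𝒟 R H ([ x ∶ a ] φ) {X} {Y} {f} r c (e , Xe , lab , s)
  with Iso.f-total (IsHH.iso H X Y f r) e Xe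
... | e' , fee' =
  e' , proj₂ (Iso.f-within i e e' fee') , trans (sym (Iso.f-label i e e' fee')) lab ,
  hh-preserves-sat 𝒞 𝒟 R H φ r (Pair.corresponds-bind 𝒞 𝒟 φ x (λ y fy y≢x → c y (fy , y≢x)) (λ _ _ p → p) fee') s
  where i = IsHH.iso H X Y f r
hh-preserves-sat 𝒞 𝒟 R H (⟪ x ⟫ φ) {X} {Y} {f} r c (W , d , stepW , ρx , perm , s)
  with c x (inj₂ refl)
... | d' , e , ρx' , ρ'x , fd'e with just-injective (trans (sym ρx') ρx)
...   | refl with IsHH.bwd-C H X Y f (ConfStr.ℓ 𝒞 d) W r (d , stepW , refl)
...     | Y'' , f'' , (e'' , stepY , _) , r'' , restr =
  Y'' , e'' , stepY , trans ρ'x (cong just e≡e'') ,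
  Pair.corresponds-permissible 𝒞 𝒟 {φ = φ} (IsHH.iso H W Y'' f'' r'') c'' ,
  hh-preserves-sat 𝒞 𝒟 R H φ r'' c'' s
  where
    c'' : Pair.Corresponds 𝒞 𝒟 f'' φ _ _
    c'' = Pair.corresponds-restrict 𝒞 𝒟 {φ = φ} (λ y fy → c y (inj₁ fy)) perm restr
    e≡e'' : e ≡ e''
    e≡e'' = Iso.f-func (IsHH.iso H X Y f r) d e e'' fd'e
              (Pair.step-matched 𝒞 𝒟 (IsHH.iso H W Y'' f'' r'') (IsHH.iso H X Y f r) restr stepW stepY)

hh⇒eil : ∀ {Act : Set} (𝒞 𝒟 : ConfStr Act) → HHBisimilar 𝒞 𝒟 → EILEquiv 𝒞 𝒟
hh⇒eil 𝒞 𝒟 (R , H) φ closed =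
  mk⇔ (hh-preserves-sat 𝒞 𝒟 R H φ (IsHH.init H) (λ x fx → ⊥-elim (closed x fx)))
      (hh-preserves-sat 𝒟 𝒞 _ (Pair.hh-converse 𝒞 𝒟 H) φ (IsHH.init H) (λ x fx → ⊥-elim (closed x fx)))

slotEnv : ∀ {A : Set} → List A → Env A
slotEnv [] _ = nothing
slotEnv (a ∷ as) zero = nothing
slotEnv (a ∷ as) (suc zero) = just a
slotEnv (a ∷ as) (suc (suc n)) = slotEnv as n

slotEnv-∈ : ∀ {A : Set} {as : List A} {a} → a ∈ as → ∃[ k ] slotEnv as (slot k) ≡ just a
slotEnv-∈ (here refl) = 0 , refl
slotEnv-∈ (there a∈as) = let (k , p) = slotEnv-∈ a∈as in suc k , p

slotOrZero : ∀ {Q : ℕ → Set} → Dec (Σ ℕ Q) → ℕ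
slotOrZero (yes (k , _)) = slot k
slotOrZero (no _) = 0

slotOrZero-spec : ∀ {Q : ℕ → Set} (D : Dec (Σ ℕ Q)) →
                  (Σ ℕ λ k → slotOrZero D ≡ slot k × Q k) ⊎ (slotOrZero D ≡ 0 × ¬ Σ ℕ Q)
slotOrZero-spec (yes (k , q)) = inj₁ (k , refl , q)
slotOrZero-spec (no none) = inj₂ (refl , none)

∈-toList : ∀ {A : Set} {P : A → Set} {xs : List A} (ps : All P xs) {x} → x ∈ xs →
           ∃[ p ] ((x , p) ∈ All.toList ps)
∈-toList (p ∷ ps) (here refl) = p , here refl
∈-toList (p ∷ ps) (there x∈xs) = let (q , m) = ∈-toList ps x∈xs in q , there m

any-toList : ∀ {A : Set₁} {P R : A → Set} {xs : List A} (ps : All P xs) →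
             Any R xs → Any (λ t → R (proj₁ t)) (All.toList ps)
any-toList (p ∷ ps) (here r) = here r
any-toList (p ∷ ps) (there rs) = there (any-toList ps rs)

module Completeness {Act : Set} (em : EM) (𝒞 𝒟 : ConfStr Act) (stC : Stable 𝒞) (stD : Stable 𝒟) where
  private
    module C = ConfStr 𝒞
    module D = ConfStr 𝒟
    module SC = Structure em 𝒞
    module SD = Structure em 𝒟
    module SCS = SC.Stability stC
    module SDS = SD.Stability stD
  open Pair 𝒞 𝒟

  LogEquiv : EvRel 𝒞 𝒟 → SubsetOf C.Ev → SubsetOf D.Ev → Set₁
  LogEquiv f X Y = ∀ φ ρ ρ' → Corresponds f φ ρ ρ' → SC.Sat X ρ φ ⇔ SD.Sat Y ρ' φ

  Related : SubsetOf C.Ev → SubsetOf D.Ev → EvRel 𝒞 𝒟 → Set₁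
  Related X Y f = C.IsConf X × D.IsConf Y × Iso 𝒞 𝒟 f X Y × LogEquiv f X Y

  Restrict : EvRel 𝒞 𝒟 → SubsetOf C.Ev → EvRel 𝒞 𝒟
  Restrict f X' d e = f d e × X' d

  -- A reverse step X' —e→ X is matched in Y by undoing the f-image of e:
  -- witnessed by the formula ⟪0⟫tt.
  reverse-match : ∀ {f X Y X' e e₂} → LogEquiv f X Y → f e e₂ → SC.Step X' e X →
                  ∃[ Y' ] SD.Step Y' e₂ Y
  reverse-match {f} {X} {Y} {X'} {e} {e₂} E fee₂ stepX
    with to (E (⟪ 0 ⟫ tt) (pairEnv e e) (pairEnv e₂ e₂) c₀) (X' , e , stepX , refl , (λ _ ()) , lift ⋆)
    where
      c₀ : Corresponds f (⟪ 0 ⟫ tt) (pairEnv e e) (pairEnv e₂ e₂)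
      c₀ y (inj₂ refl) = e , e₂ , refl , refl , fee₂
      c₀ y (inj₁ ())
  ... | Y' , _ , stepY , refl , _ = Y' , stepY

  restrict-iso : ∀ {f X Y X' Y' e e₂} → Iso 𝒞 𝒟 f X Y → SC.Step X' e X → SD.Step Y' e₂ Y → f e e₂ →
                 Iso 𝒞 𝒟 (Restrict f X') X' Y'
  restrict-iso {f} {X} {Y} {X'} {Y'} {e} {e₂} i stepX@(cX' , cX , X'⊆X , _) stepY@(cY' , cY , Y'⊆Y , _) fee₂ =
    record
      { f-within = within
      ; f-total = λ d X'd → let (e' , fde') = f-total d (X'⊆X d X'd) in e' , fde' , X'd
      ; f-surj = λ e' Y'e' → let (d , fde') = f-surj e' (Y'⊆Y e' Y'e') in
          d , fde' , SC.step-old stepX (proj₁ (f-within d e' fde'))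
                       (λ { refl → proj₂ (SD.step-new stepY) (subst Y' (f-func e e' e₂ fde' fee₂) Y'e') })
      ; f-func = λ d e' e'' (p , _) (q , _) → f-func d e' e'' p q
      ; f-inj = λ d d' e' (p , _) (q , _) → f-inj d d' e' p q
      ; f-label = λ d e' (p , _) → f-label d e' p
      ; f-order = λ d d' e' e'' (p , X'd) (q , X'd') →
          ⇔.trans (SCS.<-restrict cX' cX X'⊆X X'd')
            (⇔.trans (f-order d d' e' e'' p q)
               (⇔.sym (SDS.<-restrict cY' cY Y'⊆Y (proj₂ (within d' e'' (q , X'd'))))))
      }
    where
      open Iso i
      within : ∀ d e' → Restrict f X' d e' → X' d × Y' e'
      within d e' (fde' , X'd) =
        X'd , SD.step-old stepY (proj₂ (f-within d e' fde'))
                (λ { refl → proj₂ (SC.step-new stepX) (subst X' (f-inj d e e₂ fde' fee₂) X'd) })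

  -- Restricting along matched reverse steps also preserves logical equivalence:
  -- a formula at X' is a formula ⟪x⟫φ at X, for x fresh bound to the undone event.
  restrict-logequiv : ∀ {f X Y X' Y' e e₂} → Iso 𝒞 𝒟 f X Y → LogEquiv f X Y →
                      SC.Step X' e X → SD.Step Y' e₂ Y → f e e₂ → LogEquiv (Restrict f X') X' Y'
  restrict-logequiv {f} {X} {Y} {X'} {Y'} {e} {e₂} i E stepX stepY fee₂ φ ρ ρ' c =
    mk⇔ (λ s → SD.undo-fresh⁻ φ stepY (to (E (⟪ x ⟫ φ) _ _ c↑) (SC.undo-fresh⁺ φ stepX permC s)))
        (λ s → SC.undo-fresh⁻ φ stepX (from (E (⟪ x ⟫ φ) _ _ c↑) (SD.undo-fresh⁺ φ stepY permD s)))
    where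
      x = fresh φ
      c↑ : Corresponds f (⟪ x ⟫ φ) (ρ [ x ↦ e ]) (ρ' [ x ↦ e₂ ])
      c↑ y (inj₁ fy) = let (d , e' , ρy , ρ'y , (fde' , _)) = c y fy in
        d , e' , trans (update-there ρ e (fresh-not-free φ y fy)) ρy ,
        trans (update-there ρ' e₂ (fresh-not-free φ y fy)) ρ'y , fde'
      c↑ y (inj₂ refl) = e , e₂ , update-here ρ x e , update-here ρ' x e₂ , fee₂
      permC : Permissible ρ φ X'
      permC y fy = let (d , _ , ρy , _ , (_ , X'd)) = c y fy in d , ρy , X'd
      permD : Permissible ρ' φ Y'
      permD = corresponds-permissible {φ = φ} (restrict-iso i stepX stepY fee₂) c

  backward-step : ∀ X Y f a X' → Related X Y f → _—⟨_⟩→_ 𝒞 X' a X →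
                  ∃[ Y' ] ∃[ f' ] (_—⟨_⟩→_ 𝒟 Y' a Y × Related X' Y' f' × _↾_≡ʳ_ 𝒞 𝒟 f X' f')
  backward-step X Y f a X' (cX , cY , i , E) (e , stepX , lab) =
    let (e₂ , fee₂) = Iso.f-total i e (proj₁ (SC.step-new stepX))
        (Y' , stepY) = reverse-match E fee₂ stepX in
    Y' , Restrict f X' , (e₂ , stepY , trans (sym (Iso.f-label i e e₂ fee₂)) lab) ,
    (proj₁ stepX , proj₁ stepY , restrict-iso i stepX stepY fee₂ , restrict-logequiv i E stepX stepY fee₂) ,
    λ d e → ⇔.refl

  -- Logically equivalent configurations agree on causality between related
  -- events: a failure of d ≤ d' on one side is expressed by an undoing formula.
  ≤-preserved : ∀ {g X Y d d' e e'} → C.IsConf X → D.IsConf Y → LogEquiv g X Y →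
                X d → Y e → g d e → g d' e' → (_≤⟨_⟩_ 𝒞 d X d') ⇔ (_≤⟨_⟩_ 𝒟 e Y e')
  ≤-preserved {g} {X} {Y} {d} {d'} {e} {e'} cX cY E Xd Ye gde gd'e' = mk⇔ forth back
    where
      c : ∀ bs → Corresponds g (undoing bs) (pairEnv d d') (pairEnv e e')
      c bs y fy with fi-undoing bs y fy
      ... | inj₁ refl = d , e , refl , refl , gde
      ... | inj₂ refl = d' , e' , refl , refl , gd'e'
      forth : _≤⟨_⟩_ 𝒞 d X d' → _≤⟨_⟩_ 𝒟 e Y e'
      forth d≤d' with SD.decide₁ (_≤⟨_⟩_ 𝒟 e Y e')
      ... | yes e≤e' = e≤e'
      ... | no e≰e' = let (bs , s) = SDS.not-below⇒undoing cY Ye e≰e' in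
        ⊥-elim (SCS.undoing-sound bs (from (E (undoing bs) _ _ (c bs)) s) refl refl d≤d')
      back : _≤⟨_⟩_ 𝒟 e Y e' → _≤⟨_⟩_ 𝒞 d X d'
      back e≤e' with SC.decide₁ (_≤⟨_⟩_ 𝒞 d X d')
      ... | yes d≤d' = d≤d'
      ... | no d≰d' = let (bs , s) = SCS.not-below⇒undoing cX Xd d≰d' in
        ⊥-elim (SDS.undoing-sound bs (to (E (undoing bs) _ _ (c bs)) s) refl refl e≤e')

  Extend : EvRel 𝒞 𝒟 → C.Ev → D.Ev → EvRel 𝒞 𝒟
  Extend f e e' d e₂ = f d e₂ ⊎ (d ≡ e × e₂ ≡ e')

  -- Extending f : X ≅ Y along equally labelled forward steps gives a
  -- bijection X' → Y'; it is order preserving as soon as it is logically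
  -- justified, by ≤-preserved.
  extend-iso : ∀ {f X Y X' Y' e e'} → Iso 𝒞 𝒟 f X Y → SC.Step X e X' → SD.Step Y e' Y' →
               C.ℓ e ≡ D.ℓ e' → LogEquiv (Extend f e e') X' Y' → Iso 𝒞 𝒟 (Extend f e e') X' Y'
  extend-iso {f} {X} {Y} {X'} {Y'} {e} {e'} i stepX@(_ , cX' , X⊆X' , _) stepY@(_ , cY' , Y⊆Y' , _) ℓe≡ℓe' E =
    record
      { f-within = within
      ; f-total = total
      ; f-surj = surj
      ; f-func = func
      ; f-inj = inj
      ; f-label = label
      ; f-order = λ d d' e₂ e₂' p q →
          let ≤⇔ = ≤-preserved cX' cY' E (proj₁ (within d e₂ p)) (proj₂ (within d e₂ p)) p q in
          mk⇔ (λ (d≤d' , d≢d') → to ≤⇔ d≤d' , λ { refl → d≢d' (inj d d' e₂ p q) })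
              (λ (e₂≤e₂' , e₂≢e₂') → from ≤⇔ e₂≤e₂' , λ { refl → e₂≢e₂' (func d e₂ e₂' p q) })
      }
    where
      open Iso i
      X'e : X' e
      X'e = proj₁ (SC.step-new stepX)
      ¬Xe : ¬ X e
      ¬Xe = proj₂ (SC.step-new stepX)
      Y'e' : Y' e'
      Y'e' = proj₁ (SD.step-new stepY)
      ¬Ye' : ¬ Y e'
      ¬Ye' = proj₂ (SD.step-new stepY)
      within : ∀ d e₂ → Extend f e e' d e₂ → X' d × Y' e₂
      within d e₂ (inj₁ p) = X⊆X' d (proj₁ (f-within d e₂ p)) , Y⊆Y' e₂ (proj₂ (f-within d e₂ p))
      within d e₂ (inj₂ (refl , refl)) = X'e , Y'e'
      total : ∀ d → X' d → ∃[ e₂ ] Extend f e e' d e₂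
      total d X'd with SC.decide (d ≡ e)
      ... | yes d≡e = e' , inj₂ (d≡e , refl)
      ... | no d≢e = let (e₂ , p) = f-total d (SC.step-old stepX X'd d≢e) in e₂ , inj₁ p
      surj : ∀ e₂ → Y' e₂ → ∃[ d ] Extend f e e' d e₂
      surj e₂ Y'e₂ with SD.decide (e₂ ≡ e')
      ... | yes e₂≡e' = e , inj₂ (refl , e₂≡e')
      ... | no e₂≢e' = let (d , p) = f-surj e₂ (SD.step-old stepY Y'e₂ e₂≢e') in d , inj₁ p
      func : ∀ d e₂ e₃ → Extend f e e' d e₂ → Extend f e e' d e₃ → e₂ ≡ e₃
      func d e₂ e₃ (inj₁ p) (inj₁ q) = f-func d e₂ e₃ p q
      func d e₂ e₃ (inj₁ p) (inj₂ (refl , _)) = ⊥-elim (¬Xe (proj₁ (f-within _ _ p)))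
      func d e₂ e₃ (inj₂ (refl , _)) (inj₁ q) = ⊥-elim (¬Xe (proj₁ (f-within _ _ q)))
      func d e₂ e₃ (inj₂ (_ , refl)) (inj₂ (_ , refl)) = refl
      inj : ∀ d d' e₂ → Extend f e e' d e₂ → Extend f e e' d' e₂ → d ≡ d'
      inj d d' e₂ (inj₁ p) (inj₁ q) = f-inj d d' e₂ p q
      inj d d' e₂ (inj₁ p) (inj₂ (_ , refl)) = ⊥-elim (¬Ye' (proj₂ (f-within _ _ p)))
      inj d d' e₂ (inj₂ (_ , refl)) (inj₁ q) = ⊥-elim (¬Ye' (proj₂ (f-within _ _ q)))
      inj d d' e₂ (inj₂ (refl , _)) (inj₂ (refl , _)) = refl
      label : ∀ d e₂ → Extend f e e' d e₂ → C.ℓ d ≡ D.ℓ e₂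
      label d e₂ (inj₁ p) = f-label d e₂ p
      label d e₂ (inj₂ (refl , refl)) = ℓe≡ℓe'

  -- EIL-equivalent structures relate their empty configurations: a formula
  -- with corresponding environments along the empty relation is closed.
  related-initial : EILEquiv 𝒞 𝒟 → Related ∅ ∅ (λ _ _ → ⊥)
  related-initial eil = Stable.empty-conf stC , Stable.empty-conf stD , empty-iso , empty-equiv
    where
      empty-iso : Iso 𝒞 𝒟 (λ _ _ → ⊥) ∅ ∅
      empty-iso = record
        { f-within = λ _ _ ()
        ; f-total = λ _ ()
        ; f-surj = λ _ ()
        ; f-func = λ _ _ _ ()
        ; f-inj = λ _ _ _ ()
        ; f-label = λ _ _ ()
        ; f-order = λ _ _ _ _ () }
      empty-equiv : LogEquiv (λ _ _ → ⊥) ∅ ∅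
      empty-equiv φ ρ ρ' c =
        mk⇔ (λ s → SD.sat-transport φ SD.≐-refl none (to (eil φ closed) (SC.sat-transport φ SC.≐-refl none s)))
            (λ s → SC.sat-transport φ SC.≐-refl none (from (eil φ closed) (SD.sat-transport φ SD.≐-refl none s)))
        where
          closed : Closed φ
          closed x fx = let (_ , _ , _ , _ , impossible) = c x fx in impossible
          none : ∀ {E : Set} {τ τ' : Env E} → ∀ y → FI φ y → τ y ≡ τ' y
          none y fy = ⊥-elim (closed y fy)

  -- Canonical environments for f : X ≅ Y: σ enumerates X at the slots and σ'
  -- places at each slot the f-image of the event σ has there.
  module Enumeration {f X Y} (cX : C.IsConf X) (i : Iso 𝒞 𝒟 f X Y) where
    open Iso i

    private
      events : List C.Ev
      events = proj₁ (C.conf-fin X cX)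

      images : All (λ d → X d × Σ D.Ev (f d)) events
      images = All.tabulate λ {d} d∈ → let Xd = from (proj₂ (C.conf-fin X cX) d) d∈ in Xd , f-total d Xd

      table : Env (Σ C.Ev λ d → X d × Σ D.Ev (f d))
      table = slotEnv (All.toList images)

    σ : Env C.Ev
    σ n = Maybe.map proj₁ (table n)

    σ' : Env D.Ev
    σ' n = Maybe.map (λ t → proj₁ (proj₂ (proj₂ t))) (table n)

    σ-defined : ∀ n d → σ n ≡ just d → X d × ∃[ e ] (σ' n ≡ just e × f d e)
    σ-defined n d σn with table n
    σ-defined n d refl | just (_ , Xd , e , fde) = Xd , e , refl , fde

    σ-covers : ∀ d → X d → ∃[ k ] (σ (slot k) ≡ just d)
    σ-covers d Xd =
      let (p , m) = ∈-toList images (to (proj₂ (C.conf-fin X cX) d) Xd)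
          (k , q) = slotEnv-∈ m in
      k , cong (Maybe.map proj₁) q

  -- The forward transfer property for a related triple (X, Y, f) and a step
  -- X —e→ X': among the finitely many a-successors of Y, one justifies the
  -- extension of f by e.
  module Forward (ifD : ImageFinite 𝒟) {X Y f a X' e} (cX : C.IsConf X) (cY : D.IsConf Y)
                 (i : Iso 𝒞 𝒟 f X Y) (E : LogEquiv f X Y) (stepX : SC.Step X e X') (lab : C.ℓ e ≡ a) where
    open Iso i
    open Enumeration cX i

    ¬Xe : ¬ X e
    ¬Xe = proj₂ (SC.step-new stepX)

    Candidate : Set₁
    Candidate = Σ (SubsetOf D.Ev) λ Y' → _—⟨_⟩→_ 𝒟 Y a Y'

    Matches : Candidate → Set₁
    Matches (Y' , e' , _) = LogEquiv (Extend f e e') X' Y'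

    Refutes : Form Act → Candidate → Set₁
    Refutes Ψ (Y' , e' , _) = ¬ SD.Sat Y' (σ' [ 0 ↦ e' ]) Ψ

    Fails : SubsetOf D.Ev → D.Ev → Set₁
    Fails Y' e' = Σ (Form Act) λ φ → Σ (Env C.Ev) λ ρ → Σ (Env D.Ev) λ ρ' →
                  Corresponds (Extend f e e') φ ρ ρ' × SC.Sat X' ρ φ × ¬ SD.Sat Y' ρ' φ

    -- Classically, an extension is justified unless some formula fails
    -- (a failure from right to left is a failure of the negation).
    matches-unless-fails : ∀ Y' e' → ¬ Fails Y' e' → LogEquiv (Extend f e e') X' Y'
    matches-unless-fails Y' e' no-failure φ ρ ρ' c = mk⇔ forth back
      where
        forth : SC.Sat X' ρ φ → SD.Sat Y' ρ' φ
        forth s with SD.decide₁ (SD.Sat Y' ρ' φ)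
        ... | yes s' = s'
        ... | no ¬s' = ⊥-elim (no-failure (φ , ρ , ρ' , c , s , ¬s'))
        back : SD.Sat Y' ρ' φ → SC.Sat X' ρ φ
        back s' with SC.decide₁ (SC.Sat X' ρ φ)
        ... | yes s = s
        ... | no ¬s = ⊥-elim (no-failure (¬ᶠ φ , ρ , ρ' , c , ¬s , λ ¬s' → ¬s' s'))

    Canonical : Form Act → Set
    Canonical χ = ∀ y → FI χ y → y ≢ 0 → ∃[ d ] (σ y ≡ just d)

    -- A failing formula can be renamed so that it uses only the canonical
    -- identifiers: ρ(u) is renamed to the slot where σ has it, or to 0 (the new
    -- event) if it is not in X.
    distinguish : ∀ {Y' e'} → Fails Y' e' →
                  Σ (Form Act) λ χ → SC.Sat X' (σ [ 0 ↦ e ]) χ × Canonical χ × ¬ SD.Sat Y' (σ' [ 0 ↦ e' ]) χ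
    distinguish {Y'} {e'} (φ , ρ , ρ' , c , s , ¬s') =
      rename r φ , from (SC.sat-rename φ separated (λ y fy → proj₁ (fits y fy))) s ,
      canonical , λ s'' → ¬s' (to (SD.sat-rename φ separated (λ y fy → proj₂ (fits y fy))) s'')
      where
        InSlot : ℕ → ℕ → Set
        InSlot u k = Σ C.Ev λ d → ρ u ≡ just d × σ (slot k) ≡ just d

        r : ℕ → ℕ
        r u = slotOrZero (SC.decide (Σ ℕ (InSlot u)))

        r-spec : ∀ u → (Σ ℕ λ k → r u ≡ slot k × InSlot u k) ⊎ (r u ≡ 0 × ¬ Σ ℕ (InSlot u))
        r-spec u = slotOrZero-spec (SC.decide (Σ ℕ (InSlot u)))

        separated : Separated r
        separated x y _ ry≡bx with r-spec y
        ... | inj₁ (k , ry , _) = slot≢double k (suc x) (trans (sym ry) ry≡bx)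
        ... | inj₂ (ry , _) with trans (sym ry) ry≡bx
        ...   | ()

        fits : ∀ y → FI φ y → (σ [ 0 ↦ e ]) (r y) ≡ ρ y × (σ' [ 0 ↦ e' ]) (r y) ≡ ρ' y
        fits y fy with c y fy | r-spec y
        ... | d , e₂ , ρy , ρ'y , p | inj₁ (k , ry , d' , ρy' , σk)
          with just-injective (trans (sym ρy) ρy')
        ...   | refl with σ-defined (slot k) d σk
        ...     | Xd , e₅ , σ'k , fde₅ =
          trans (cong (σ [ 0 ↦ e ]) ry) (trans (update-there σ e (slot≢double k 0)) (trans σk (sym ρy))) ,
          trans (cong (σ' [ 0 ↦ e' ]) ry)
            (trans (update-there σ' e' (slot≢double k 0)) (trans σ'k (trans (cong just (old-image p)) (sym ρ'y))))
          where
            old-image : Extend f e e' d e₂ → e₅ ≡ e₂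
            old-image (inj₁ fde₂) = f-func d e₅ e₂ fde₅ fde₂
            old-image (inj₂ (refl , _)) = ⊥-elim (¬Xe Xd)
        fits y fy | d , e₂ , ρy , ρ'y , inj₁ fde₂ | inj₂ (_ , not-in-slot) =
          let (k , σk) = σ-covers d (proj₁ (f-within d e₂ fde₂)) in ⊥-elim (not-in-slot (k , d , ρy , σk))
        fits y fy | d , e₂ , ρy , ρ'y , inj₂ (refl , refl) | inj₂ (ry , _) =
          trans (cong (σ [ 0 ↦ e ]) ry) (trans (update-here σ 0 e) (sym ρy)) ,
          trans (cong (σ' [ 0 ↦ e' ]) ry) (trans (update-here σ' 0 e') (sym ρ'y))

        canonical : Canonical (rename r φ)
        canonical y fy y≢0 with fi-rename⁻ φ separated fy
        ... | u , _ , refl with r-spec u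
        ...   | inj₁ (k , ry , d , _ , σk) = d , trans (cong σ ry) σk
        ...   | inj₂ (ry , _) = ⊥-elim (y≢0 ry)

    canonical-∧ : ∀ χ Ψ → Canonical χ → Canonical Ψ → Canonical (χ ∧ᶠ Ψ)
    canonical-∧ χ Ψ canχ canΨ y (inj₁ fy) = canχ y fy
    canonical-∧ χ Ψ canχ canΨ y (inj₂ fy) = canΨ y fy

    -- Hennessy–Milner: either some candidate matches, or a single canonical
    -- formula true at X' is refuted by every candidate (conjoin the renamed
    -- distinguishing formulas).
    separate : (cs : List Candidate) →
               Any Matches cs ⊎
               Σ (Form Act) (λ Ψ → SC.Sat X' (σ [ 0 ↦ e ]) Ψ × Canonical Ψ × All (Refutes Ψ) cs)
    separate [] = inj₂ (tt , lift ⋆ , (λ _ ()) , [])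
    separate (cand@(Y' , e' , _) ∷ cs) with SC.decide₁ (Fails Y' e')
    ... | no no-failure = inj₁ (here (matches-unless-fails Y' e' no-failure))
    ... | yes failure with separate cs
    ...   | inj₁ m = inj₁ (there m)
    ...   | inj₂ (Ψ , sΨ , canΨ , refuted) =
      let (χ , sχ , canχ , ¬s'χ) = distinguish failure in
      inj₂ (χ ∧ᶠ Ψ , (sχ , sΨ) , canonical-∧ χ Ψ canχ canΨ ,
            (λ (s'χ , _) → ¬s'χ s'χ) ∷ All.map (λ ¬s'Ψ (_ , s'Ψ) → ¬s'Ψ s'Ψ) refuted)

    unrefuted : ∀ Ψ {Y'' e''} → SD.Step Y e'' Y'' → SD.Sat Y'' (σ' [ 0 ↦ e'' ]) Ψ →
                (c : Candidate) → Y'' ≐ proj₁ c → ¬ Refutes Ψ c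
    unrefuted Ψ stepY'' s'' (Y₃ , e₃ , step₃ , _) Y''≐Y₃ ¬s₃ with SD.step-event-unique stepY'' step₃ Y''≐Y₃
    ... | refl = ¬s₃ (SD.sat-transport Ψ Y''≐Y₃ (λ _ _ → refl) s'')

    -- A canonical formula true after the step from X is true after some step
    -- from Y, by logical equivalence applied to ⟨0 ∶ a⟩Ψ; so it cannot be
    -- refuted by all candidates.
    not-all-refuted : ∀ Ψ → SC.Sat X' (σ [ 0 ↦ e ]) Ψ → Canonical Ψ →
                      ∀ {Ys} (steps : All (λ Y' → _—⟨_⟩→_ 𝒟 Y a Y') Ys) →
                      (∀ Y'' → _—⟨_⟩→_ 𝒟 Y a Y'' → Any (λ Y₃ → Y'' ≐ Y₃) Ys) →
                      ¬ All (Refutes Ψ) (All.toList steps)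
    not-all-refuted Ψ s canΨ steps cover refuted =
      let (Y'' , e'' , stepY'' , lab'' , s'') = to (E (⟨ 0 ∶ a ⟩ Ψ) σ σ' c) (X' , e , stepX , lab , s)
          found = any-toList steps (cover Y'' (e'' , stepY'' , lab''))
          (¬s₃ , Y''≐Y₃) = All.lookupAny refuted found in
      unrefuted Ψ stepY'' s'' (Any.lookup found) Y''≐Y₃ ¬s₃
      where
        c : Corresponds f (⟨ 0 ∶ a ⟩ Ψ) σ σ'
        c y (fy , y≢0) = let (d , σy) = canΨ y fy y≢0 ; (_ , e₂ , σ'y , fde₂) = σ-defined y d σy in
                         d , e₂ , σy , σ'y , fde₂

    matching-step : ∃[ c ] Matches c
    matching-step with ifD Y a cY
    ... | Ys , steps , cover with separate (All.toList steps)
    ...   | inj₁ m = Any.satisfied m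
    ...   | inj₂ (Ψ , s , canΨ , refuted) = ⊥-elim (not-all-refuted Ψ s canΨ steps cover refuted)

  forward-step : ImageFinite 𝒟 → ∀ X Y f a X' → Related X Y f → _—⟨_⟩→_ 𝒞 X a X' →
                 ∃[ Y' ] ∃[ f' ] (_—⟨_⟩→_ 𝒟 Y a Y' × Related X' Y' f' × _↾_≡ʳ_ 𝒞 𝒟 f' X f)
  forward-step ifD X Y f a X' (cX , cY , i , E) (e , stepX , lab)
    with Forward.matching-step ifD cX cY i E stepX lab
  ... | (Y' , e' , stepY , lab') , E' =
    Y' , Extend f e e' , (e' , stepY , lab') ,
    (proj₁ (proj₂ stepX) , proj₁ (proj₂ stepY) , extend-iso i stepX stepY (trans lab (sym lab')) E' , E') ,
    λ d e₂ → mk⇔ (λ { (inj₁ fde₂ , _) → fde₂ ; (inj₂ (refl , _) , Xe) → ⊥-elim (proj₂ (SC.step-new stepX) Xe) })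
                 (λ fde₂ → inj₁ fde₂ , proj₁ (Iso.f-within i d e₂ fde₂))

-- Completeness: the candidate relation is an HH bisimulation; the moves of 𝒟
-- are handled by the same argument applied to the converse relation.
eil⇒hh : ∀ {Act : Set} → EM → (𝒞 𝒟 : ConfStr Act) → Stable 𝒞 → Stable 𝒟 →
         ImageFinite 𝒞 → ImageFinite 𝒟 → EILEquiv 𝒞 𝒟 → HHBisimilar 𝒞 𝒟
eil⇒hh em 𝒞 𝒟 stC stD ifC ifD eil = CD.Related , record
  { init = CD.related-initial eil
  ; confs = λ X Y f (cX , cY , _) → cX , cY
  ; iso = λ X Y f (_ , _ , i , _) → i
  ; fwd-C = CD.forward-step ifD
  ; fwd-D = λ X Y f a Y' r step →
      let (X' , g , step' , r' , restr) = DC.forward-step ifC Y X (converse f) a Y' (to-converse r) step in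
      X' , converse g , step' , from-converse r' ,
      λ d e → Pair.restriction-swap 𝒟 𝒞 (iso-of r') (iso-of (to-converse r)) restr e d
  ; bwd-C = CD.backward-step
  ; bwd-D = λ X Y f a Y' r step →
      let (X' , g , step' , r' , restr) = DC.backward-step Y X (converse f) a Y' (to-converse r) step in
      X' , converse g , step' , from-converse r' ,
      λ d e → Pair.restriction-swap 𝒟 𝒞 (iso-of (to-converse r)) (iso-of r') restr e d
  }
  where
    module CD = Completeness em 𝒞 𝒟 stC stD
    module DC = Completeness em 𝒟 𝒞 stD stC

    iso-of : ∀ {X Y g} → DC.Related Y X g → Iso 𝒟 𝒞 g Y X
    iso-of (_ , _ , i , _) = i

    to-converse : ∀ {X Y f} → CD.Related X Y f → DC.Related Y X (converse f)
    to-converse (cX , cY , i , E) = cY , cX , Pair.iso-converse 𝒞 𝒟 i ,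
      λ φ ρ' ρ c → ⇔.sym (E φ ρ ρ' (Pair.corresponds-converse 𝒟 𝒞 {φ = φ} c))

    from-converse : ∀ {X Y g} → DC.Related Y X g → CD.Related X Y (converse g)
    from-converse (cY , cX , i , E) = cX , cY , Pair.iso-converse 𝒟 𝒞 i ,
      λ φ ρ ρ' c → ⇔.sym (E φ ρ' ρ (Pair.corresponds-converse 𝒞 𝒟 {φ = φ} c))

theorem1 : ExcludedMiddle (Level.suc (Level.suc 0ℓ)) →
    {Act : Set} (𝒞 𝒟 : ConfStr Act) →
    Stable 𝒞 → Stable 𝒟 → ImageFinite 𝒞 → ImageFinite 𝒟 →
    HHBisimilar 𝒞 𝒟 ⇔ EILEquiv 𝒞 𝒟
theorem1 em 𝒞 𝒟 stC stD ifC ifD = mk⇔ (hh⇒eil 𝒞 𝒟) (eil⇒hh em 𝒞 𝒟 stC stD ifC ifD)
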